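{- Let $\mathbf{w}$ be an infinite binary word with factor complexity at most $2n$ (for every $n\ge1$, at most $2n$ distinct factors of length $n$) which avoids $(5/2)^+$-powers. Then both $0011$ and $1100$ are factors of $\mathbf{w}$.
   Context: For a finite word of length $\ell$ with smallest period $p$, its exponent is $\ell/p$; a $(5/2)^+$-power is a word of exponent $>5/2$; a word avoids $(5/2)^+$-powers if none of its factors is a $(5/2)^+$-power. -}

module Defs where

open import Data.Nat using (ℕ; zero; suc; _+_; _*_; _≤_; _<_)
open import Data.Empty using (⊥)
open import Data.Bool using (Bool; true; false)
open import Data.List using (List; []; _∷_; length; map)
open import Data.List.Relation.Unary.All using (All)
open import Data.List.Relation.Unary.Unique.Propositional using (Unique)
open import Data.Product using (Σ; ∃; _×_; _,_)
open import Relation.Binary.PropositionalEquality using (_≡_)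

-- Infinite binary words (0 = false, 1 = true).
Word : Set
Word = ℕ → Bool

factorAt : Word → ℕ → ℕ → List Bool
factorAt w i zero    = []
factorAt w i (suc n) = w i ∷ factorAt w (suc i) n

IsFactor : Word → List Bool → Set
IsFactor w u = ∃ λ i → factorAt w i (length u) ≡ u

ComplexityAtMost2n : Word → Set
ComplexityAtMost2n w = ∀ (n : ℕ) → 1 ≤ n → (fs : List (List Bool)) →
  Unique fs → All (λ u → IsFactor w u × length u ≡ n) fs → length fs ≤ 2 * n

_‼_ : List Bool → ℕ → Bool
[] ‼ _ = false
(x ∷ xs) ‼ zero = x
(x ∷ xs) ‼ suc k = xs ‼ k

IsPeriod : List Bool → ℕ → Set
IsPeriod u p = 1 ≤ p × p ≤ length u × (∀ j → j + p < length u → u ‼ j ≡ u ‼ (j + p))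

IsSmallestPeriod : List Bool → ℕ → Set
IsSmallestPeriod u p = IsPeriod u p × (∀ q → IsPeriod u q → p ≤ q)

-- u is a (5/2)^+-power: exponent |u|/p > 5/2 where p is its smallest period,
-- i.e. 2|u| > 5p.
Is52PlusPower : List Bool → Set
Is52PlusPower u = ∃ λ p → IsSmallestPeriod u p × 5 * p < 2 * length u

Avoids52Plus : Word → Set
Avoids52Plus w = ∀ u → IsFactor w u → Is52PlusPower u → ⊥

-- Exhaustive search over prefixes. Extend the empty word letter by letter: within 32
-- letters every branch either contains the wanted factor, or reaches a prefix with more
-- than 8 distinct factors of length 4, or one ending in a (5/2)⁺-power. A word with
-- complexity at most 2n avoiding (5/2)⁺-powers has no such prefix, so its own branch
-- must contain the factor.
module Submission where

open import Defs
open import Data.Bool using (Bool; true; false; T; _∧_; _∨_)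
open import Data.List using (List; []; _∷_; length; map; take; drop; tails; filter; deduplicate; _∷ʳ_)
open import Data.Product using (_×_; ∃; _,_; proj₁; proj₂)

open import Data.Bool.Properties using (T-∧; T-∨; T-≡) renaming (_≟_ to _≟ᵇ_)
open import Data.List.Properties using (≡-dec)
open import Data.List.Relation.Binary.Infix.Heterogeneous using (Infix; here; there)
open import Data.List.Relation.Binary.Infix.Heterogeneous.Properties using (infix?; Prefix-Infix-trans; fromPointwise)
open import Data.List.Relation.Binary.Prefix.Heterogeneous using (Prefix; []; _∷_)
import Data.List.Relation.Binary.Pointwise as Pointwise
open import Data.List.Relation.Unary.All as All using (All; []; _∷_)
open import Data.List.Relation.Unary.All.Properties using (map⁺; filter⁺; all-filter; deduplicate⁺)
open import Data.List.Relation.Unary.Unique.DecPropositional.Properties using (deduplicate-!)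
open import Data.Nat using (ℕ; zero; suc; _+_; _*_; _∸_; _≤_; _<_; s≤s; z≤n; _≟_; _≤?_; _<?_; ⌊_/2⌋)
open import Data.Nat.Induction using (<-wellFounded)
open import Data.Nat.Properties
  using (anyUpTo?; allUpTo?; m+n≤o⇒m≤o∸n; m≤o∸n⇒m+n≤o; ≤-<-trans; *-monoʳ-≤; <⇒≱; ≮⇒≥; +-suc)
open import Data.Sum using (_⊎_; inj₁; inj₂)
open import Function using (_∘_; Equivalence)
open import Induction.WellFounded using (Acc; acc)
open import Level using (Level)
open import Relation.Binary.PropositionalEquality using (_≡_; refl; sym; cong; subst; trans; module ≡-Reasoning)
open import Relation.Nullary using (¬_; Dec; yes; no; contradiction)
open import Relation.Nullary.Decidable using (⌊_⌋; map′; _×-dec_; _⊎-dec_; toWitness)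
open import Relation.Unary using (Pred; Decidable)

private
  variable
    ℓ : Level
    A : Set
    P : Pred ℕ ℓ

least-witness : Decidable P → ∀ {n} → P n → ∃ λ m → P m × (∀ k → P k → m ≤ k)
least-witness {P = P} P? = go (<-wellFounded _)
  where
  go : ∀ {n} → Acc _<_ n → P n → ∃ λ m → P m × (∀ k → P k → m ≤ k)
  go {n} (acc below) pn with anyUpTo? P? n
  ... | yes (k , k<n , pk) = go (below k<n) pk
  ... | no none            = n , pn , λ k pk → ≮⇒≥ (λ k<n → none (k , k<n , pk))

periodic? : ∀ u p → p ≤ length u → Dec (∀ j → j + p < length u → u ‼ j ≡ u ‼ (j + p))
periodic? u p p≤∣u∣ = map′
  (λ below j j+p<∣u∣ → below (m+n≤o⇒m≤o∸n (suc j) j+p<∣u∣))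
  (λ periodic {j} j<∣u∣∸p → periodic j (m≤o∸n⇒m+n≤o (suc j) p≤∣u∣ j<∣u∣∸p))
  (allUpTo? (λ j → u ‼ j ≟ᵇ u ‼ (j + p)) (length u ∸ p))

isPeriod? : ∀ u p → Dec (IsPeriod u p)
isPeriod? u p with p ≤? length u
... | no p≰∣u∣  = no (p≰∣u∣ ∘ proj₁ ∘ proj₂)
... | yes p≤∣u∣ = map′
  (λ (1≤p , periodic) → 1≤p , p≤∣u∣ , periodic)
  (λ (1≤p , _ , periodic) → 1≤p , periodic)
  (1 ≤? p ×-dec periodic? u p p≤∣u∣)

Is52PlusPowerOfPeriod : ℕ → List Bool → Set
Is52PlusPowerOfPeriod p u = 5 * p < 2 * length u × IsPeriod u p

is52PlusPowerOfPeriod? : ∀ p u → Dec (Is52PlusPowerOfPeriod p u)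
is52PlusPowerOfPeriod? p u = 5 * p <? 2 * length u ×-dec isPeriod? u p

is52PlusPowerOfPeriod⇒is52PlusPower : ∀ u p → Is52PlusPowerOfPeriod p u → Is52PlusPower u
is52PlusPowerOfPeriod⇒is52PlusPower u p (short , period) =
  let q , q-period , q-least = least-witness (isPeriod? u) period
  in q , (q-period , q-least) , ≤-<-trans (*-monoʳ-≤ 5 (q-least p period)) short

prefix⇒factorAt : ∀ {w i k v} → Prefix _≡_ v (factorAt w i k) → factorAt w i (length v) ≡ v
prefix⇒factorAt {k = zero}  []              = refl
prefix⇒factorAt {k = suc k} []              = refl
prefix⇒factorAt {k = suc k} (refl ∷ v⊑rest) = cong (_ ∷_) (prefix⇒factorAt v⊑rest)

infix⇒factor : ∀ {w i k v} → Infix _≡_ v (factorAt w i k) → IsFactor w v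
infix⇒factor {k = suc k} (there v⊑u) = infix⇒factor v⊑u
infix⇒factor {i = i}     (here v⊑u)  = i , prefix⇒factorAt v⊑u

take-prefix : ∀ n (xs : List A) → Prefix _≡_ (take n xs) xs
take-prefix zero    xs       = []
take-prefix (suc n) []       = []
take-prefix (suc n) (x ∷ xs) = refl ∷ take-prefix n xs

drop-infix : ∀ n (xs : List A) → Infix _≡_ (drop n xs) xs
drop-infix zero    xs       = fromPointwise (Pointwise.refl refl)
drop-infix (suc n) []       = here []
drop-infix (suc n) (x ∷ xs) = there (drop-infix n xs)

tails-infix : ∀ (xs : List A) → All (λ ys → Infix _≡_ ys xs) (tails xs)
tails-infix []       = here [] ∷ []
tails-infix (x ∷ xs) = drop-infix 0 (x ∷ xs) ∷ All.map there (tails-infix xs)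

hasLength? : ∀ n → Decidable (λ (xs : List A) → length xs ≡ n)
hasLength? n xs = length xs ≟ n

windows : ℕ → List A → List (List A)
windows n xs = filter (hasLength? n) (map (take n) (tails xs))

windows-infix : ∀ n (xs : List A) → All (λ ys → Infix _≡_ ys xs × length ys ≡ n) (windows n xs)
windows-infix n xs = All.zip
  ( filter⁺ (hasLength? n) (map⁺ (All.map (Prefix-Infix-trans trans (take-prefix n _)) (tails-infix xs)))
  , all-filter (hasLength? n) (map (take n) (tails xs)) )

distinctFactors : ℕ → List Bool → List (List Bool)
distinctFactors n u = deduplicate (≡-dec _≟ᵇ_) (windows n u)

distinctFactors-bound : ∀ {w} → ComplexityAtMost2n w → ∀ {n} → 1 ≤ n → ∀ i k →
  length (distinctFactors n (factorAt w i k)) ≤ 2 * n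
distinctFactors-bound cplx {n} 1≤n i k = cplx n 1≤n _
  (deduplicate-! (≡-dec _≟ᵇ_) _)
  (deduplicate⁺ (≡-dec _≟ᵇ_) (All.map (λ (v⊑u , ∣v∣≡n) → infix⇒factor v⊑u , ∣v∣≡n) (windows-infix n _)))

-- A (5/2)⁺-power of period p ending u has a suffix of length ⌊5p/2⌋ + 1, which is again
-- a (5/2)⁺-power of period p; so these are the only suffixes that need testing.
powerCandidate : ℕ → List Bool → List Bool
powerCandidate p u = drop (length u ∸ suc ⌊ 5 * p /2⌋) u

powerCandidate-infix : ∀ p u → Infix _≡_ (powerCandidate p u) u
powerCandidate-infix p u = drop-infix (length u ∸ suc ⌊ 5 * p /2⌋) u

EndsIn52PlusPower : List Bool → Set
EndsIn52PlusPower u = ∃ λ p → p < length u × Is52PlusPowerOfPeriod p (powerCandidate p u)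

endsIn52PlusPower? : Decidable EndsIn52PlusPower
endsIn52PlusPower? u = anyUpTo? (λ p → is52PlusPowerOfPeriod? p (powerCandidate p u)) (length u)

Forbidden : ℕ → List Bool → Set
Forbidden n u = 2 * n < length (distinctFactors n u) ⊎ EndsIn52PlusPower u

forbidden? : ∀ n → Decidable (Forbidden n)
forbidden? n u = 2 * n <? length (distinctFactors n u) ⊎-dec endsIn52PlusPower? u

factorAt-allowed : ∀ {w} → ComplexityAtMost2n w → Avoids52Plus w → ∀ {n} → 1 ≤ n → ∀ i k →
  ¬ Forbidden n (factorAt w i k)
factorAt-allowed cplx avoid 1≤n i k (inj₁ tooMany) =
  <⇒≱ tooMany (distinctFactors-bound cplx 1≤n i k)
factorAt-allowed {w} cplx avoid 1≤n i k (inj₂ (p , _ , power)) =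
  avoid (powerCandidate p u) (infix⇒factor (powerCandidate-infix p u))
    (is52PlusPowerOfPeriod⇒is52PlusPower (powerCandidate p u) p power)
  where u = factorAt w i k

prefix : Word → ℕ → List Bool
prefix w = factorAt w 0

factorAt-suc : ∀ w i k → factorAt w i (suc k) ≡ factorAt w i k ∷ʳ w (k + i)
factorAt-suc w i zero    = refl
factorAt-suc w i (suc k) = cong (w i ∷_) (begin
  factorAt w (suc i) (suc k)              ≡⟨ factorAt-suc w (suc i) k ⟩
  factorAt w (suc i) k ∷ʳ w (k + suc i)   ≡⟨ cong (λ j → factorAt w (suc i) k ∷ʳ w j) (+-suc k i) ⟩
  factorAt w (suc i) k ∷ʳ w (suc (k + i)) ∎)
  where open ≡-Reasoning

-- The tests are Booleans rather than decision procedures: the implicit predicates of the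
-- latter may be solved in eta-different forms, and two copies of a search term that are not
-- syntactically equal make the conversion checker evaluate the whole search again.
module PrefixSearch (good bad : List Bool → Bool) where

  inevitable : ℕ → List Bool → Bool
  settled    : ℕ → List Bool → Bool

  inevitable zero    u = good u
  inevitable (suc n) u = good u ∨ (settled n (u ∷ʳ false) ∧ settled n (u ∷ʳ true))

  settled n v = bad v ∨ inevitable n v

  settled-∷ʳ : ∀ n u b → T (settled n (u ∷ʳ false) ∧ settled n (u ∷ʳ true)) → T (settled n (u ∷ʳ b))
  settled-∷ʳ n u false = proj₁ ∘ Equivalence.to T-∧
  settled-∷ʳ n u true  = proj₂ ∘ Equivalence.to T-∧

  inevitable-sound : ∀ w → (∀ k → ¬ T (bad (prefix w k))) →
    ∀ n → inevitable n [] ≡ true → ∃ λ k → T (good (prefix w k))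
  inevitable-sound w allowed n = from 0 n ∘ Equivalence.from T-≡
    where
    from : ∀ k n → T (inevitable n (prefix w k)) → ∃ λ k → T (good (prefix w k))
    from k zero    found = k , found
    from k (suc n) t with Equivalence.to T-∨ t
    ... | inj₁ found = k , found
    ... | inj₂ both
      with Equivalence.to T-∨ (subst (T ∘ settled n) (sym (factorAt-suc w 0 k)) (settled-∷ʳ n _ (w (k + 0)) both))
    ...   | inj₁ bad  = contradiction bad (allowed (suc k))
    ...   | inj₂ next = from (suc k) n next

open PrefixSearch using (inevitable; inevitable-sound)

contains : List Bool → List Bool → Bool
contains f u = ⌊ infix? _≟ᵇ_ f u ⌋

forbidden : ℕ → List Bool → Bool
forbidden n u = ⌊ forbidden? n u ⌋

unavoidable : ∀ f → inevitable (contains f) (forbidden 4) 32 [] ≡ true →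
  ∀ w → ComplexityAtMost2n w → Avoids52Plus w → IsFactor w f
unavoidable f found w cplx avoid =
  let k , f⊑prefix = inevitable-sound (contains f) (forbidden 4) w
                       (λ k → factorAt-allowed cplx avoid (s≤s z≤n) 0 k ∘ toWitness) 32 found
  in infix⇒factor (toWitness f⊑prefix)

0011-unavoidable : inevitable (contains (false ∷ false ∷ true ∷ true ∷ [])) (forbidden 4) 32 [] ≡ true
0011-unavoidable = refl

1100-unavoidable : inevitable (contains (true ∷ true ∷ false ∷ false ∷ [])) (forbidden 4) 32 [] ≡ true
1100-unavoidable = refl

lemma3 : (w : Word) → ComplexityAtMost2n w → Avoids52Plus w →
    IsFactor w (false ∷ false ∷ true ∷ true ∷ []) × IsFactor w (true ∷ true ∷ false ∷ false ∷ [])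
lemma3 w cplx avoid =
  unavoidable (false ∷ false ∷ true ∷ true ∷ []) 0011-unavoidable w cplx avoid ,
  unavoidable (true ∷ true ∷ false ∷ false ∷ []) 1100-unavoidable w cplx avoid
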